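{- Let $b_0,b_1\in\omega^\omega$ be increasing functions, let $b_1^*\in\omega^\omega$ be defined by $b_1^*(0)=0$ and $b_1^*(n+1)=b_1(b_1^*(n)+1)$, and let $\varphi\in\mathcal{S}_{b_0}$. (1) If $b_1\not\leq^*b_0$, then there is $\varphi^*\in\mathcal{S}^{\mathrm{w}}_{b_1^*}$ such that $H_{b_0,\varphi}\subseteq H_{b_1^*,\varphi^*}$. (2) If $b_0\leq^*b_1$, then there is $\varphi_*\in\mathcal{S}_{b_1^*}$ such that $H_{b_0,\varphi}\subseteq H_{b_1^*,\varphi_*}$.
   Context: For an increasing $b\in\omega^\omega$: $\mathcal{S}_b$ is the set of sequences $\varphi=\langle\varphi(n):n<\omega\rangle$ with $\varphi(n)\subseteq2^{[b(n),b(n+1))}$ and $\frac{|\varphi(n)|}{2^{b(n+1)-b(n)}}\leq\frac{1}{2^n}$ for all $n$; $\mathcal{S}^{\mathrm{w}}_b$ is the set of such sequences with $\varphi(n)\subseteq2^{[b(n),b(n+1))}$ and $\frac{|\varphi(n)|}{2^{b(n+1)-b(n)}}\leq\frac{1}{2^n}$ for infinitely many $n$. For such $\varphi$, $H_{b,\varphi}=\{x\in2^\omega: x{\upharpoonright}[b(n),b(n+1))\in\varphi(n)\text{ for all but finitely many }n\}$. $x\leq^*y$ means $x(n)\leq y(n)$ for all but finitely many $n$. -}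

module Defs where

open import Data.Nat using (ℕ; zero; suc; _+_; _*_; _∸_; _^_; _≤_; _<_)
open import Data.Bool using (Bool; true; false; if_then_else_)
open import Data.Vec using (Vec; []; _∷_; tabulate)
open import Data.Fin using (Fin; toℕ)
open import Data.Product using (Σ; _×_; ∃)
open import Relation.Binary.PropositionalEquality using (_≡_)

Cantor : Set
Cantor = ℕ → Bool

SubsetOf2^ : ℕ → Set
SubsetOf2^ L = Vec Bool L → Bool

card : {L : ℕ} → SubsetOf2^ L → ℕ
card {zero}  p = if p [] then 1 else 0
card {suc L} p = card (λ v → p (true ∷ v)) + card (λ v → p (false ∷ v))

len : (ℕ → ℕ) → ℕ → ℕ
len b n = b (suc n) ∸ b n

restrict : Cantor → (a L : ℕ) → Vec Bool L
restrict x a L = tabulate (λ i → x (a + toℕ i))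

Seq : (ℕ → ℕ) → Set
Seq b = (n : ℕ) → SubsetOf2^ (len b n)

-- |φ(n)| / 2^(b(n+1)-b(n)) ≤ 1/2^n
Small : (b : ℕ → ℕ) → Seq b → ℕ → Set
Small b φ n = card (φ n) * 2 ^ n ≤ 2 ^ len b n

InS : (b : ℕ → ℕ) → Seq b → Set
InS b φ = ∀ n → Small b φ n

InSw : (b : ℕ → ℕ) → Seq b → Set
InSw b φ = ∀ N → Σ ℕ (λ n → N ≤ n × Small b φ n)

InH : (b : ℕ → ℕ) → Seq b → Cantor → Set
InH b φ x = Σ ℕ (λ N → ∀ n → N ≤ n → φ n (restrict x (b n) (len b n)) ≡ true)

HSubset : (b : ℕ → ℕ) → Seq b → (b' : ℕ → ℕ) → Seq b' → Set
HSubset b φ b' φ' = ∀ x → InH b φ x → InH b' φ' x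

Increasing : (ℕ → ℕ) → Set
Increasing b = ∀ m n → m < n → b m < b n

_≤*_ : (ℕ → ℕ) → (ℕ → ℕ) → Set
x ≤* y = Σ ℕ (λ N → ∀ n → N ≤ n → x n ≤ y n)

_≰*_ : (ℕ → ℕ) → (ℕ → ℕ) → Set
x ≰* y = ∀ N → Σ ℕ (λ n → N ≤ n × y n < x n)

star : (ℕ → ℕ) → ℕ → ℕ
star b zero    = 0
star b (suc n) = b (suc (star b n))

-- Cut the b₁*-blocks so that a block [b₁*(k), b₁*(k+1)) contains a whole b₀-block m ≥ k
-- whenever possible, and let φ*(k) demand that x restricted to that b₀-block lies in φ(m).
-- Since only |φ(m)|/2^|block m| ≤ 2^-m ≤ 2^-k of the patterns survive, φ*(k) is small,
-- and every x ∈ H_{b₀,φ} eventually satisfies φ*(k). If b₀ ≤* b₁, the b₀-block starting at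
-- b₁*(k) fits for almost all k; if b₁ ≰* b₀, for infinitely many k one of the b₀-blocks
-- b₁*(k) or b₁*(k-1)+1 fits. Blocks without a fitting b₀-block get the trivial set 2^L
-- (for the weak family) or the empty set (for the strong one).
module Submission where

open import Defs
open import Data.Nat using (ℕ; zero; suc; _+_; _*_; _∸_; _^_; _≤_; _<_; z≤n; s≤s; _≤?_; _⊔_)
open import Data.Nat.Properties
open import Data.Bool using (Bool; true; false)
open import Data.Vec using (Vec; []; _∷_; tabulate)
open import Data.Vec.Properties using (tabulate-cong)
open import Data.Fin using (Fin; toℕ; fromℕ<)
open import Data.Fin.Properties using (toℕ-fromℕ<; toℕ<n; any?)
open import Data.Product using (Σ; ∃; _×_; _,_)
open import Data.Sum using (_⊎_; inj₁; inj₂)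
open import Relation.Nullary using (Dec; yes; no)
open import Relation.Nullary.Decidable using (_×-dec_)
open import Relation.Binary.PropositionalEquality
open import Data.Empty using (⊥-elim)
open import Data.Nat.Solver using (module +-*-Solver)
open +-*-Solver

StepIncreasing : (ℕ → ℕ) → Set
StepIncreasing a = ∀ k → a k < a (suc k)

Increasing⇒step : ∀ {a} → Increasing a → StepIncreasing a
Increasing⇒step inc k = inc k (suc k) (n<1+n k)

inflationary : ∀ {a} → StepIncreasing a → ∀ k → k ≤ a k
inflationary inc zero    = z≤n
inflationary inc (suc k) = ≤-<-trans (inflationary inc k) (inc k)

Increasing⇒mono : ∀ {a} → Increasing a → ∀ {m n} → m ≤ n → a m ≤ a n
Increasing⇒mono inc {m} {n} m≤n with m≤n⇒m<n∨m≡n m≤n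
... | inj₁ m<n  = <⇒≤ (inc m n m<n)
... | inj₂ refl = ≤-refl

block-of : ∀ {a} → StepIncreasing a → ∀ {N n} → a N < n →
  ∃ λ k → N ≤ k × a k < n × n ≤ a (suc k)
block-of inc {N} {suc n} (s≤s aN≤n) with m≤n⇒m<n∨m≡n aN≤n
... | inj₂ refl = N , ≤-refl , ≤-refl , inc N
... | inj₁ aN<n with block-of inc aN<n
...   | k , N≤k , ak<n , n≤ask with m≤n⇒m<n∨m≡n n≤ask
...     | inj₁ n<ask = k , N≤k , <-≤-trans ak<n (n≤1+n n) , n<ask
...     | inj₂ refl  = suc k , ≤-trans N≤k (n≤1+n k) , ≤-refl , inc (suc k)

star-step : ∀ {b} → Increasing b → ∀ k → suc (star b k) ≤ star b (suc k)
star-step inc k = inflationary (Increasing⇒step inc) (suc (star _ k))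

toCantor : ∀ {L} → Vec Bool L → Cantor
toCantor []      _       = false
toCantor (a ∷ v) zero    = a
toCantor (a ∷ v) (suc i) = toCantor v i

toCantor-tabulate : ∀ {L} (f : Fin L → Bool) i (i<L : i < L) →
  toCantor (tabulate f) i ≡ f (fromℕ< i<L)
toCantor-tabulate {suc L} f zero    _         = refl
toCantor-tabulate {suc L} f (suc i) (s≤s i<L) = toCantor-tabulate (λ j → f (Fin.suc j)) i i<L

toCantor-restrict : ∀ x a L i → i < L → toCantor (restrict x a L) i ≡ x (a + i)
toCantor-restrict x a L i i<L =
  trans (toCantor-tabulate _ i i<L) (cong (λ t → x (a + t)) (toℕ-fromℕ< i<L))

restrict-restrict : ∀ x a L o l → o + l ≤ L →
  restrict (toCantor (restrict x a L)) o l ≡ restrict x (a + o) l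
restrict-restrict x a L o l o+l≤L = tabulate-cong λ i →
  trans (toCantor-restrict x a L (o + toℕ i) (<-≤-trans (+-monoʳ-< o (toℕ<n i)) o+l≤L))
        (cong x (sym (+-assoc a o (toℕ i))))

private
  double : ∀ c y → c * y + c * y ≡ c * (2 * y)
  double = solve 2 (λ c y → c :* y :+ c :* y := c :* (con 2 :* y)) refl

card-const : ∀ L c → card {L} (λ _ → c) ≡ card {0} (λ _ → c) * 2 ^ L
card-const zero    c = sym (*-identityʳ _)
card-const (suc L) c rewrite card-const L c = double (card {0} (λ _ → c)) (2 ^ L)

card-false : ∀ L → card {L} (λ _ → false) ≡ 0
card-false zero = refl
card-false (suc L) rewrite card-false L = refl

card-preimage-restrict : ∀ {l} (q : SubsetOf2^ l) o r →
  card {o + l + r} (λ s → q (restrict (toCantor s) o l)) ≡ card q * 2 ^ (o + r)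
card-preimage-restrict {zero}  q zero r = card-const r (q [])
card-preimage-restrict {suc l} q zero r
  rewrite card-preimage-restrict (λ v → q (true ∷ v)) zero r
        | card-preimage-restrict (λ v → q (false ∷ v)) zero r =
  sym (*-distribʳ-+ (2 ^ r) (card (λ v → q (true ∷ v))) (card (λ v → q (false ∷ v))))
card-preimage-restrict q (suc o) r rewrite card-preimage-restrict q o r =
  double (card q) (2 ^ (o + r))

preimage-restrict-sparse : ∀ {l} (q : SubsetOf2^ l) {k m} o r L → L ≡ o + l + r →
  card q * 2 ^ m ≤ 2 ^ l → k ≤ m →
  card {L} (λ s → q (restrict (toCantor s) o l)) * 2 ^ k ≤ 2 ^ L
preimage-restrict-sparse {l} q {k} {m} o r _ refl q-sparse k≤m = begin
    card {o + l + r} (λ s → q (restrict (toCantor s) o l)) * 2 ^ k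
      ≡⟨ cong (_* 2 ^ k) (card-preimage-restrict q o r) ⟩
    card q * 2 ^ (o + r) * 2 ^ k
      ≤⟨ *-monoʳ-≤ (card q * 2 ^ (o + r)) (^-monoʳ-≤ 2 k≤m) ⟩
    card q * 2 ^ (o + r) * 2 ^ m
      ≡⟨ solve 3 (λ c x y → c :* x :* y := c :* y :* x) refl (card q) (2 ^ (o + r)) (2 ^ m) ⟩
    card q * 2 ^ m * 2 ^ (o + r)
      ≤⟨ *-monoˡ-≤ (2 ^ (o + r)) q-sparse ⟩
    2 ^ l * 2 ^ (o + r)
      ≡⟨ sym (^-distribˡ-+-* 2 l (o + r)) ⟩
    2 ^ (l + (o + r))
      ≡⟨ cong (2 ^_) (solve 3 (λ l o r → l :+ (o :+ r) := o :+ l :+ r) refl l o r) ⟩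
    2 ^ (o + l + r) ∎
  where open ≤-Reasoning

∸-split : ∀ {a p e} → a ≤ p → p ≤ e → e ∸ a ≡ (p ∸ a) + (e ∸ p)
∸-split {a} {p} {e} a≤p p≤e = begin
  e ∸ a                 ≡⟨ cong (_∸ a) (sym (m∸n+n≡m p≤e)) ⟩
  (e ∸ p) + p ∸ a       ≡⟨ +-∸-assoc (e ∸ p) a≤p ⟩
  (e ∸ p) + (p ∸ a)     ≡⟨ +-comm (e ∸ p) (p ∸ a) ⟩
  (p ∸ a) + (e ∸ p)     ∎
  where open ≡-Reasoning

Fits : (a b : ℕ → ℕ) → ℕ → ℕ → Set
Fits a b k m = k ≤ m × a k ≤ b m × b (suc m) ≤ a (suc k)

FitsSome : (a b : ℕ → ℕ) → ℕ → Set
FitsSome a b k = ∃ λ m → Fits a b k m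

FitsBelow : (a b : ℕ → ℕ) → ℕ → Set
FitsBelow a b k = ∃ λ (i : Fin (a (suc k))) → Fits a b k (toℕ i)

fitsBelow? : ∀ a b k → Dec (FitsBelow a b k)
fitsBelow? a b k = any? λ i → (k ≤? toℕ i) ×-dec ((a k ≤? b (toℕ i)) ×-dec (b (suc (toℕ i)) ≤? a (suc k)))

fitsSome⇒fitsBelow : ∀ {a b} → Increasing b → ∀ {k} → FitsSome a b k → FitsBelow a b k
fitsSome⇒fitsBelow {a} {b} b-inc {k} (m , fits@(_ , _ , bsm≤ask)) =
  fromℕ< m<ask , subst (Fits a b k) (sym (toℕ-fromℕ< m<ask)) fits
  where
    m<ask : m < a (suc k)
    m<ask = ≤-<-trans (inflationary (Increasing⇒step b-inc) m)
                      (<-≤-trans (b-inc m (suc m) (n<1+n m)) bsm≤ask)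

module Transfer (a b : ℕ → ℕ) (b-inc : Increasing b) (φ : Seq b) (φ∈S : InS b φ) where

  len-split : ∀ {k m} → Fits a b k m → len a k ≡ (b m ∸ a k) + len b m + (a (suc k) ∸ b (suc m))
  len-split {k} {m} (_ , ak≤bm , bsm≤ask) = begin
    a (suc k) ∸ a k
      ≡⟨ ∸-split ak≤bm (≤-trans bm≤bsm bsm≤ask) ⟩
    (b m ∸ a k) + (a (suc k) ∸ b m)
      ≡⟨ cong ((b m ∸ a k) +_) (∸-split bm≤bsm bsm≤ask) ⟩
    (b m ∸ a k) + (len b m + (a (suc k) ∸ b (suc m)))
      ≡⟨ sym (+-assoc (b m ∸ a k) (len b m) _) ⟩
    (b m ∸ a k) + len b m + (a (suc k) ∸ b (suc m)) ∎
    where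
      open ≡-Reasoning
      bm≤bsm = <⇒≤ (b-inc m (suc m) (n<1+n m))

  pullback : ∀ k m → SubsetOf2^ (len a k)
  pullback k m s = φ m (restrict (toCantor s) (b m ∸ a k) (len b m))

  pullback-small : ∀ {k m} → Fits a b k m → card (pullback k m) * 2 ^ k ≤ 2 ^ len a k
  pullback-small {k} {m} fits@(k≤m , _) =
    preimage-restrict-sparse (φ m) (b m ∸ a k) _ (len a k) (len-split fits) (φ∈S m) k≤m

  pullback-∋ : ∀ x {k m} → Fits a b k m → φ m (restrict x (b m) (len b m)) ≡ true →
    pullback k m (restrict x (a k) (len a k)) ≡ true
  pullback-∋ x {k} {m} fits@(_ , ak≤bm , _) x∈φm = trans (cong (φ m) (begin
      restrict (toCantor (restrict x (a k) (len a k))) (b m ∸ a k) (len b m)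
        ≡⟨ restrict-restrict x (a k) (len a k) (b m ∸ a k) (len b m)
             (subst ((b m ∸ a k) + len b m ≤_) (sym (len-split fits)) (m≤m+n _ _)) ⟩
      restrict x (a k + (b m ∸ a k)) (len b m)
        ≡⟨ cong (λ c → restrict x c (len b m)) (m+[n∸m]≡n ak≤bm) ⟩
      restrict x (b m) (len b m) ∎)) x∈φm
    where open ≡-Reasoning

  select : ∀ k → Dec (FitsBelow a b k) → Bool → SubsetOf2^ (len a k)
  select k (yes (i , _)) d = pullback k (toℕ i)
  select k (no _)        d = λ _ → d

  transferred : Bool → Seq a
  transferred d k = select k (fitsBelow? a b k) d

  fitsSome⇒small : ∀ d {k} → FitsSome a b k → Small a (transferred d) k
  fitsSome⇒small d {k} fits with fitsBelow? a b k
  ... | yes (_ , fits′) = pullback-small fits′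
  ... | no ¬fits = ⊥-elim (¬fits (fitsSome⇒fitsBelow {a} b-inc fits))

  transferred-false-small : InS a (transferred false)
  transferred-false-small k with fitsBelow? a b k
  ... | yes (_ , fits) = pullback-small fits
  ... | no _ rewrite card-false (len a k) = z≤n

  transferred-∋ : ∀ d x N → (∀ n → N ≤ n → φ n (restrict x (b n) (len b n)) ≡ true) →
    ∀ k → N ≤ k → (d ≡ true ⊎ FitsSome a b k) → transferred d k (restrict x (a k) (len a k)) ≡ true
  transferred-∋ d x N x∈H k N≤k d⊎fits with fitsBelow? a b k | d⊎fits
  ... | yes (i , fits@(k≤i , _)) | _ = pullback-∋ x fits (x∈H (toℕ i) (≤-trans N≤k k≤i))
  ... | no _        | inj₁ refl = refl
  ... | no ¬fits    | inj₂ fits =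
    ⊥-elim (¬fits (fitsSome⇒fitsBelow {a} b-inc fits))

  transferred-true-⊇ : HSubset b φ a (transferred true)
  transferred-true-⊇ x (N , x∈H) = N , λ k N≤k → transferred-∋ true x N x∈H k N≤k (inj₁ refl)

  frequently-fits⇒InSw : (∀ N → ∃ λ k → N ≤ k × FitsSome a b k) → InSw a (transferred true)
  frequently-fits⇒InSw often N with often N
  ... | k , N≤k , fits = k , N≤k , fitsSome⇒small true fits

  eventually-fits⇒⊇ : (∃ λ N → ∀ k → N ≤ k → FitsSome a b k) → HSubset b φ a (transferred false)
  eventually-fits⇒⊇ (N₀ , fits) x (N , x∈H) = N ⊔ N₀ , λ k N⊔N₀≤k →
    transferred-∋ false x N x∈H k (≤-trans (m≤m⊔n N N₀) N⊔N₀≤k)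
      (inj₂ (fits k (≤-trans (m≤n⊔m N N₀) N⊔N₀≤k)))

module _ (b₀ b₁ : ℕ → ℕ) (inc₀ : Increasing b₀) (inc₁ : Increasing b₁) where

  private
    k≤b₁*k : ∀ k → k ≤ star b₁ k
    k≤b₁*k = inflationary (star-step inc₁)

    block-start-fits : ∀ {k} → b₀ (suc (star b₁ k)) ≤ star b₁ (suc k) → Fits (star b₁) b₀ k (star b₁ k)
    block-start-fits le = k≤b₁*k _ , inflationary (Increasing⇒step inc₀) _ , le

  eventually-fits : b₀ ≤* b₁ → ∃ λ N → ∀ k → N ≤ k → FitsSome (star b₁) b₀ k
  eventually-fits (N , b₀≤b₁) = N , λ k N≤k →
    star b₁ k , block-start-fits (b₀≤b₁ _ (≤-trans N≤k (≤-trans (k≤b₁*k k) (n≤1+n _))))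

  -- Take n > b₁*(N) with b₀(n) < b₁(n) and its b₁*-block k. Either the b₀-block starting at
  -- b₁*(k) fits into block k, or it overlaps b₁*(k+1) and the next one fits into block k+1.
  frequently-fits : b₁ ≰* b₀ → ∀ N → ∃ λ k → N ≤ k × FitsSome (star b₁) b₀ k
  frequently-fits b₁≰b₀ N with b₁≰b₀ (suc (star b₁ N))
  ... | n , b₁*N<n , b₀n<b₁n with block-of (star-step inc₁) b₁*N<n
  ...   | k , N≤k , b₁*k<n , n≤b₁*sk with b₀ (suc (star b₁ k)) ≤? star b₁ (suc k)
  ...     | yes le = k , N≤k , star b₁ k , block-start-fits le
  ...     | no  gt = suc k , ≤-trans N≤k (n≤1+n k) , suc (star b₁ k) ,
                     s≤s (k≤b₁*k k) , <⇒≤ (≰⇒> gt) , next-end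
    where
      next-end : b₀ (suc (suc (star b₁ k))) ≤ star b₁ (suc (suc k))
      next-end with m≤n⇒m<n∨m≡n b₁*k<n
      ... | inj₂ refl = ⊥-elim (<-irrefl refl (<-trans b₀n<b₁n (≰⇒> gt)))
      ... | inj₁ lt   = <⇒≤ (≤-<-trans (Increasing⇒mono inc₀ lt)
                          (<-≤-trans b₀n<b₁n (Increasing⇒mono inc₁ (≤-trans n≤b₁*sk (n≤1+n _)))))

lemma7p5 : (b₀ b₁ : ℕ → ℕ) → Increasing b₀ → Increasing b₁ →
    (φ : Seq b₀) → InS b₀ φ →
      (b₁ ≰* b₀ → Σ (Seq (star b₁)) (λ φ* → InSw (star b₁) φ* × HSubset b₀ φ (star b₁) φ*))
      × (b₀ ≤* b₁ → Σ (Seq (star b₁)) (λ φ* → InS (star b₁) φ* × HSubset b₀ φ (star b₁) φ*))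
lemma7p5 b₀ b₁ inc₀ inc₁ φ φ∈S =
  (λ b₁≰b₀ → transferred true ,
     frequently-fits⇒InSw (frequently-fits b₀ b₁ inc₀ inc₁ b₁≰b₀) , transferred-true-⊇) ,
  (λ b₀≤b₁ → transferred false ,
     transferred-false-small , eventually-fits⇒⊇ (eventually-fits b₀ b₁ inc₀ inc₁ b₀≤b₁))
  where open Transfer (star b₁) b₀ inc₀ φ φ∈S
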